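{- For all $i,\ell\in\mathbb{N}$ (with $i\ge1$) there is a $(2^{i-1}-1,\,i+\ell,\,2^{i-1},\,2^i-1)$-blurer.
   Context: For $\Xi\subseteq\mathbb{Z}_{2^q}^d$, $N\subseteq[d]$, $\bar b\in\mathbb{Z}_{2^q}^{|N|}$ let $\#_{N,\bar b}(\Xi)=|\{\bar c\in\Xi:\bar c|_N=\bar b\}|\bmod2$, where $\bar c|_N$ is the restriction to indices in $N$ (in increasing order). For $d\ge k$ and $a\in\mathbb{Z}_{2^q}$, $\Xi$ is a $(k,q,a,d)$-blurer if for all $N\subseteq[d]$ with $|N|=k$: (1) $\sum_j\xi(j)=0$ in $\mathbb{Z}_{2^q}$ for all $\xi\in\Xi$; (2) if $1\in N$ then $\#_{N,(a,0,\dots,0)}(\Xi)=1$; (3) if $1\notin N$ then $\#_{N,\bar0}(\Xi)=1$; (4) $\#_{N,\bar b}(\Xi)=0$ for all other pairs $N,\bar b$. -}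

module Defs where

open import Data.Nat using (ℕ; zero; suc; _+_; _∸_; _^_; _%_; _≤_)
open import Data.Nat.Divisibility using (_∣_)
open import Data.Bool using (Bool; true; false)
open import Data.Fin using (Fin; toℕ)
open import Data.Fin.Subset using (Subset; ∣_∣)
open import Data.Vec using (Vec; []; _∷_)
open import Data.List using (List; []; _∷_; map; filter; length; replicate)
open import Data.List.Properties using (≡-dec)
open import Data.List.Relation.Unary.Unique.Propositional using (Unique)
open import Data.List.Relation.Unary.All using (All)
import Data.Nat.Properties as ℕP
open import Relation.Binary.PropositionalEquality using (_≡_; _≢_)

-- ℤ_{2^q} is represented by Fin (2 ^ q) (residues 0 … 2^q - 1).
-- Indices [d] = {1,…,d} are represented by Fin d, index 1 being Fin.zero.

restrict : ∀ {A : Set} {d} → Subset d → Vec A d → List A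
restrict []          []       = []
restrict (true ∷ N)  (x ∷ c)  = x ∷ restrict N c
restrict (false ∷ N) (x ∷ c)  = restrict N c

firstIn : ∀ {d} → Subset d → Bool
firstIn []      = false
firstIn (x ∷ _) = x

vsum : ∀ {m d} → Vec (Fin m) d → ℕ
vsum []      = 0
vsum (x ∷ v) = toℕ x + vsum v

-- #_{N,b}(Ξ) = |{c ∈ Ξ : c|_N = b}| mod 2
-- (b given as a list of residues; comparison is done on the residues as naturals)
count# : ∀ {m d} → Subset d → List ℕ → List (Vec (Fin m) d) → ℕ
count# N b Ξ = length (filter (λ c → ≡-dec ℕP._≟_ (map toℕ (restrict N c)) b) Ξ) % 2

special : ∀ {m d} → Fin m → Subset d → List ℕ
special a N with firstIn N
... | true  = toℕ a ∷ replicate (∣ N ∣ ∸ 1) 0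
... | false = replicate ∣ N ∣ 0

-- Ξ ⊆ ℤ_{2^q}^d (a set, i.e. a duplicate-free list) is a (k,q,a,d)-blurer
record Blurer (k q : ℕ) (a : Fin (2 ^ q)) (d : ℕ) (Ξ : List (Vec (Fin (2 ^ q)) d)) : Set where
  field
    d≥k     : k ≤ d
    isSet   : Unique Ξ
    sumZero : All (λ ξ → (2 ^ q) ∣ vsum ξ) Ξ
    special1 : ∀ (N : Subset d) → ∣ N ∣ ≡ k → count# N (special a N) Ξ ≡ 1
    others0  : ∀ (N : Subset d) → ∣ N ∣ ≡ k → (b : List (Fin (2 ^ q))) → length b ≡ ∣ N ∣ →
               map toℕ b ≢ special a N → count# N (map toℕ b) Ξ ≡ 0

-- Write k = 2^(i-1) - 1 and -1 = 2^q - 1 in ℤ_{2^q}. The blurer consists of the vectors (k, v) and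
-- (k + 1, v) with v ∈ {0, -1}^(2k) having exactly k, resp. k + 1, entries -1, so every coordinate
-- sum vanishes. A {0, -1}-pattern of weight w on N ⊆ [2k] is the restriction of exactly
-- C(2k - |N|, m - w) vectors of {0, -1}^(2k) of weight m, so each count is a sum of at most two
-- binomial coefficients. Their parities follow from Lucas' theorem in the form: C(2^j, s) is even
-- for 0 < s < 2^j, while C(2^j - 1, s) is odd for s < 2^j. When 1 ∈ N this leaves C(k+1, k+1) = 1
-- for the pattern (k+1, 0, …, 0) and even counts otherwise; when 1 ∉ N the pattern 0 gets
-- C(k, k) + C(k, k+1) = 1 and every other pattern two odd coefficients.

module Submission where

open import Defs
open import Data.Nat using (ℕ; suc; _∸_; _+_; _^_; _≥_)
open import Data.Fin using (Fin; toℕ)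
open import Data.Vec using (Vec)
open import Data.List using (List)
open import Data.Product using (Σ; _×_)
open import Relation.Binary.PropositionalEquality using (_≡_)

open import Data.Nat
  using (zero; _*_; _%_; _≤_; _<_; z≤n; s≤s; parity)
open import Data.Nat.Properties
open import Data.Nat.Combinatorics using (_C_; nCn≡1; nC1≡n; nCk+nC[k+1]≡[n+1]C[k+1]; k>n⇒nCk≡0)
open import Data.Nat.Divisibility using (_∣_; divides)
open import Data.Parity.Base as ℙ using (Parity; 0ℙ; 1ℙ)
import Data.Parity.Properties as ℙ
open import Data.Bool using (true; false)
open import Data.Fin using (fromℕ<)
open import Data.Fin.Properties using (toℕ-fromℕ<)
open import Data.Fin.Subset using (Subset; ∣_∣; ∁)
open import Data.Fin.Subset.Properties using (∣∁p∣≡n∸∣p∣)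
open import Data.Vec using ([]; _∷_)
open import Data.Vec.Properties using (∷-injectiveˡ; ∷-injectiveʳ)
open import Data.List using ([]; _∷_; [_]; _++_; map; filter; length; replicate)
open import Data.List.Properties as List
  using (≡-dec; filter-++; filter-none; filter-≐; length-++; length-map; length-replicate)
open import Data.List.Membership.Propositional using (_∈_)
open import Data.List.Membership.Propositional.Properties using (∈-map⁻)
open import Data.List.Relation.Unary.All as All using (All; []; _∷_)
import Data.List.Relation.Unary.All.Properties as All
open import Data.List.Relation.Unary.Unique.Propositional using (Unique; []; _∷_)
import Data.List.Relation.Unary.Unique.Propositional.Properties as Unique
open import Data.Product using (∃-syntax; _,_)
open import Data.Sum using (_⊎_; inj₁; inj₂)
open import Function using (_∘_)
open import Relation.Nullary using (¬_; yes; no; does; contradiction)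
open import Relation.Unary using (Decidable)
open import Relation.Binary.PropositionalEquality
  using (refl; sym; trans; cong; cong₂; subst; _≢_; module ≡-Reasoning)

parity-pascal : ∀ n k → parity (suc n C suc k) ≡ parity (n C k) ℙ.+ parity (n C suc k)
parity-pascal n k =
  trans (cong parity (sym (nCk+nC[k+1]≡[n+1]C[k+1] n k))) (ℙ.+-homo-+ (n C k) (n C suc k))

-- Over 𝔽₂, (1 + x)² = 1 + x², so two rows of Pascal's triangle collapse into one.
parity-pascal² : ∀ n k → parity ((2 + n) C (2 + k)) ≡ parity (n C k) ℙ.+ parity (n C (2 + k))
parity-pascal² n k = begin
  parity ((2 + n) C (2 + k))                            ≡⟨ parity-pascal (suc n) (suc k) ⟩
  parity ((1 + n) C (1 + k)) ℙ.+ parity ((1 + n) C (2 + k))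
    ≡⟨ cong₂ ℙ._+_ (parity-pascal n k) (parity-pascal n (suc k)) ⟩
  (a ℙ.+ b) ℙ.+ (b ℙ.+ c)                              ≡⟨ ℙ.+-assoc a b (b ℙ.+ c) ⟩
  a ℙ.+ (b ℙ.+ (b ℙ.+ c))                              ≡⟨ cong (a ℙ.+_) (ℙ.+-assoc b b c) ⟨
  a ℙ.+ ((b ℙ.+ b) ℙ.+ c)                              ≡⟨ cong (λ x → a ℙ.+ (x ℙ.+ c)) (ℙ.p+p≡0ℙ b) ⟩
  a ℙ.+ c                                               ∎
  where
  open ≡-Reasoning
  a b c : Parity
  a = parity (n C k)
  b = parity (n C suc k)
  c = parity (n C (2 + k))

parity-[n*2]C[1+k*2]≡0ℙ : ∀ n k → parity ((n * 2) C suc (k * 2)) ≡ 0ℙ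
parity-[n*2]C[1+k*2]≡0ℙ zero    k       = refl
parity-[n*2]C[1+k*2]≡0ℙ (suc n) zero    =
  trans (cong parity (nC1≡n (2 + n * 2))) (trans (ℙ.*-homo-* n 2) (ℙ.*-zeroʳ (parity n)))
parity-[n*2]C[1+k*2]≡0ℙ (suc n) (suc k) = trans (parity-pascal² (n * 2) (suc (k * 2)))
  (cong₂ ℙ._+_ (parity-[n*2]C[1+k*2]≡0ℙ n k) (parity-[n*2]C[1+k*2]≡0ℙ n (suc k)))

parity-[n*2]C[k*2]≡parity-nCk : ∀ n k → parity ((n * 2) C (k * 2)) ≡ parity (n C k)
parity-[n*2]C[k*2]≡parity-nCk zero    zero    = refl
parity-[n*2]C[k*2]≡parity-nCk zero    (suc k) = refl
parity-[n*2]C[k*2]≡parity-nCk (suc n) zero    = refl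
parity-[n*2]C[k*2]≡parity-nCk (suc n) (suc k) = begin
  parity ((2 + n * 2) C (2 + k * 2))                        ≡⟨ parity-pascal² (n * 2) (k * 2) ⟩
  parity ((n * 2) C (k * 2)) ℙ.+ parity ((n * 2) C (suc k * 2))
    ≡⟨ cong₂ ℙ._+_ (parity-[n*2]C[k*2]≡parity-nCk n k) (parity-[n*2]C[k*2]≡parity-nCk n (suc k)) ⟩
  parity (n C k) ℙ.+ parity (n C suc k)                    ≡⟨ parity-pascal n k ⟨
  parity (suc n C suc k)                                    ∎
  where open ≡-Reasoning

even⊎odd : ∀ s → ∃[ t ] (s ≡ t * 2 ⊎ s ≡ suc (t * 2))
even⊎odd zero = 0 , inj₁ refl
even⊎odd (suc s) with even⊎odd s
... | t , inj₁ s≡2t   = t , inj₂ (cong suc s≡2t)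
... | t , inj₂ s≡1+2t = suc t , inj₁ (cong suc s≡1+2t)

parity-[2^j]Cs≡0ℙ : ∀ j {s} → 0 < s → s < 2 ^ j → parity (2 ^ j C s) ≡ 0ℙ
parity-[2^j]Cs≡0ℙ zero    (s≤s z≤n) (s≤s ())
parity-[2^j]Cs≡0ℙ (suc j) {s} 0<s s<2^[1+j] rewrite *-comm 2 (2 ^ j) with even⊎odd s
... | t     , inj₂ refl = parity-[n*2]C[1+k*2]≡0ℙ (2 ^ j) t
... | zero  , inj₁ refl = contradiction 0<s (<-irrefl refl)
... | suc t , inj₁ refl = trans (parity-[n*2]C[k*2]≡parity-nCk (2 ^ j) (suc t))
  (parity-[2^j]Cs≡0ℙ j (s≤s z≤n) (*-cancelʳ-< _ _ _ s<2^[1+j]))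

parity-nCs≡1ℙ : ∀ {n} → (∀ {s} → 0 < s → s ≤ n → parity (suc n C s) ≡ 0ℙ) →
                ∀ {s} → s ≤ n → parity (n C s) ≡ 1ℙ
parity-nCs≡1ℙ even {zero}  _     = refl
parity-nCs≡1ℙ {n} even {suc s} 1+s≤n = ℙ.+-cancelˡ-≡ 1ℙ _ _ (begin
  1ℙ ℙ.+ parity (n C suc s)
    ≡⟨ cong (ℙ._+ parity (n C suc s)) (parity-nCs≡1ℙ even (<⇒≤ 1+s≤n)) ⟨
  parity (n C s) ℙ.+ parity (n C suc s)   ≡⟨ parity-pascal n s ⟨
  parity (suc n C suc s)                  ≡⟨ even (s≤s z≤n) 1+s≤n ⟩
  0ℙ                                      ∎)
  where open ≡-Reasoning

suc[2^n∸1]≡2^n : ∀ n → suc (2 ^ n ∸ 1) ≡ 2 ^ n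
suc[2^n∸1]≡2^n n = m+[n∸m]≡n (m^n>0 2 n)

filter-map : ∀ {a p} {A B : Set a} {P : B → Set p} (P? : Decidable P) (f : A → B) xs →
             filter P? (map f xs) ≡ map f (filter (P? ∘ f) xs)
filter-map P? f []       = refl
filter-map P? f (x ∷ xs) with does (P? (f x))
... | true  = cong (f x ∷_) (filter-map P? f xs)
... | false = filter-map P? f xs

Unique-map-∷-++ : ∀ {A : Set} {n} {x y : A} {xs ys : List (Vec A n)} →
                  x ≢ y → Unique xs → Unique ys → Unique (map (x ∷_) xs ++ map (y ∷_) ys)
Unique-map-∷-++ {x = x} {y} {xs} {ys} x≢y xs! ys! =
  Unique.++⁺ (Unique.map⁺ ∷-injectiveʳ xs!) (Unique.map⁺ ∷-injectiveʳ ys!) disjoint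
  where
  disjoint : ∀ {c} → ¬ (c ∈ map (x ∷_) xs × c ∈ map (y ∷_) ys)
  disjoint (c∈xs , c∈ys) with ∈-map⁻ (x ∷_) c∈xs | ∈-map⁻ (y ∷_) c∈ys
  ... | _ , _ , refl | _ , _ , eq = x≢y (∷-injectiveˡ eq)

module _ {M d : ℕ} where

  Matches : Subset d → List ℕ → Vec (Fin M) d → Set
  Matches N b c = map toℕ (restrict N c) ≡ b

  matches? : (N : Subset d) (b : List ℕ) → Decidable (Matches N b)
  matches? N b c = ≡-dec _≟_ (map toℕ (restrict N c)) b

  matchParity : Subset d → List ℕ → List (Vec (Fin M) d) → Parity
  matchParity N b Ξ = parity (length (filter (matches? N b) Ξ))

  count#≡1 : ∀ N b Ξ → matchParity N b Ξ ≡ 1ℙ → count# N b Ξ ≡ 1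
  count#≡1 N b Ξ = go (length (filter (matches? N b) Ξ))
    where
    go : ∀ n → parity n ≡ 1ℙ → n % 2 ≡ 1
    go 1             _   = refl
    go (suc (suc n)) odd = go n odd

  count#≡0 : ∀ N b Ξ → matchParity N b Ξ ≡ 0ℙ → count# N b Ξ ≡ 0
  count#≡0 N b Ξ = go (length (filter (matches? N b) Ξ))
    where
    go : ∀ n → parity n ≡ 0ℙ → n % 2 ≡ 0
    go 0             _    = refl
    go (suc (suc n)) even = go n even

  matchParity-++ : ∀ N b xs ys →
                   matchParity N b (xs ++ ys) ≡ matchParity N b xs ℙ.+ matchParity N b ys
  matchParity-++ N b xs ys = begin
    parity (length (filter P? (xs ++ ys)))                  ≡⟨ cong (parity ∘ length) (filter-++ P? xs ys) ⟩
    parity (length (filter P? xs ++ filter P? ys))          ≡⟨ cong parity (length-++ (filter P? xs)) ⟩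
    parity (length (filter P? xs) + length (filter P? ys))  ≡⟨ ℙ.+-homo-+ (length (filter P? xs)) _ ⟩
    matchParity N b xs ℙ.+ matchParity N b ys               ∎
    where
    open ≡-Reasoning
    P? : Decidable (Matches N b)
    P? = matches? N b

  matchParity-none : ∀ {N b Ξ} → All (¬_ ∘ Matches N b) Ξ → matchParity N b Ξ ≡ 0ℙ
  matchParity-none {N} {b} none = cong (parity ∘ length) (filter-none (matches? N b) none)

module _ {M d : ℕ} {x : Fin M} where

  matchParity-map-∷ : ∀ N b (Ξ : List (Vec (Fin M) d)) →
                      matchParity N b (map (x ∷_) Ξ) ≡ parity (length (filter (matches? N b ∘ (x ∷_)) Ξ))
  matchParity-map-∷ N b Ξ = cong parity (trans (cong length (filter-map (matches? N b) (x ∷_) Ξ))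
                                               (length-map (x ∷_) (filter (matches? N b ∘ (x ∷_)) Ξ)))

  matchParity-skip : ∀ N b (Ξ : List (Vec (Fin M) d)) →
                     matchParity (false ∷ N) b (map (x ∷_) Ξ) ≡ matchParity N b Ξ
  matchParity-skip N b = matchParity-map-∷ (false ∷ N) b

  matchParity-keep : ∀ {b₀} N b (Ξ : List (Vec (Fin M) d)) → toℕ x ≡ b₀ →
                     matchParity (true ∷ N) (b₀ ∷ b) (map (x ∷_) Ξ) ≡ matchParity N b Ξ
  matchParity-keep N b Ξ refl = trans (matchParity-map-∷ (true ∷ N) _ Ξ)
    (cong (parity ∘ length) (filter-≐ _ (matches? N b) (List.∷-injectiveʳ , cong (toℕ x ∷_)) Ξ))

  matchParity-drop : ∀ {b₀} N b (Ξ : List (Vec (Fin M) d)) → toℕ x ≢ b₀ →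
                     matchParity (true ∷ N) (b₀ ∷ b) (map (x ∷_) Ξ) ≡ 0ℙ
  matchParity-drop N b Ξ x≢b₀ =
    matchParity-none {N = true ∷ N} (All.map⁺ (All.universal (λ _ eq → x≢b₀ (List.∷-injectiveˡ eq)) Ξ))

module WeightVectors {M : ℕ} (z t : Fin M) (z≡0 : toℕ z ≡ 0) (t≢0 : toℕ t ≢ 0) where

  weightVectors : (n w : ℕ) → List (Vec (Fin M) n)
  weightVectors zero    zero    = [ [] ]
  weightVectors zero    (suc w) = []
  weightVectors (suc n) zero    = map (z ∷_) (weightVectors n zero)
  weightVectors (suc n) (suc w) = map (z ∷_) (weightVectors n (suc w)) ++ map (t ∷_) (weightVectors n w)

  -- The entries are fixed by equations, so that matching never has to unify toℕ t with 0.
  data Pattern : List ℕ → ℕ → Set where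
    []  : Pattern [] 0
    0∷ : ∀ {x b w} → x ≡ 0 → Pattern b w → Pattern (x ∷ b) w
    t∷ : ∀ {x b w} → x ≡ toℕ t → Pattern b w → Pattern (x ∷ b) (suc w)

  pattern-weight-unique : ∀ {b w w′} → Pattern b w → Pattern b w′ → w ≡ w′
  pattern-weight-unique []        []         = refl
  pattern-weight-unique (0∷ _ p)  (0∷ _ q)   = pattern-weight-unique p q
  pattern-weight-unique (0∷ e _)  (t∷ e′ _)  = contradiction (trans (sym e′) e) t≢0
  pattern-weight-unique (t∷ e _)  (0∷ e′ _)  = contradiction (trans (sym e) e′) t≢0
  pattern-weight-unique (t∷ _ p)  (t∷ _ q)   = cong suc (pattern-weight-unique p q)

  pattern-weight≤length : ∀ {b w} → Pattern b w → w ≤ length b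
  pattern-weight≤length []       = z≤n
  pattern-weight≤length (0∷ _ p) = m≤n⇒m≤1+n (pattern-weight≤length p)
  pattern-weight≤length (t∷ _ p) = s≤s (pattern-weight≤length p)

  replicate-pattern : ∀ r → Pattern (replicate r 0) 0
  replicate-pattern zero    = []
  replicate-pattern (suc r) = 0∷ refl (replicate-pattern r)

  pattern-weight-0 : ∀ {b r} → length b ≡ r → Pattern b 0 → b ≡ replicate r 0
  pattern-weight-0 refl []          = refl
  pattern-weight-0 refl (0∷ refl p) = cong (0 ∷_) (pattern-weight-0 refl p)

  pattern? : ∀ b → (∃[ w ] Pattern b w) ⊎ (∀ {w} → ¬ Pattern b w)
  pattern? []      = inj₁ (0 , [])
  pattern? (x ∷ b) with pattern? b | x ≟ 0 | x ≟ toℕ t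
  ... | inj₂ ¬p       | _        | _        = inj₂ λ { (0∷ _ p) → ¬p p ; (t∷ _ p) → ¬p p }
  ... | inj₁ (w , p)  | yes x≡0  | _        = inj₁ (w , 0∷ x≡0 p)
  ... | inj₁ (w , p)  | no _     | yes x≡t  = inj₁ (suc w , t∷ x≡t p)
  ... | inj₁ _        | no x≢0   | no x≢t   =
    inj₂ λ { (0∷ x≡0 _) → x≢0 x≡0 ; (t∷ x≡t _) → x≢t x≡t }

  LightRestriction : ∀ {n} → Subset n → ℕ → Vec (Fin M) n → Set
  LightRestriction N m c = ∃[ w ] w ≤ m × Pattern (map toℕ (restrict N c)) w

  module _ {n : ℕ} (N : Subset n) {m : ℕ} {c : Vec (Fin M) n} where

    light-z∷ : LightRestriction N m c → LightRestriction (true ∷ N) m (z ∷ c)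
    light-z∷ (w , w≤m , p) = w , w≤m , 0∷ z≡0 p

    light-t∷ : LightRestriction N m c → LightRestriction (true ∷ N) (suc m) (t ∷ c)
    light-t∷ (w , w≤m , p) = suc w , s≤s w≤m , t∷ refl p

    light-suc : LightRestriction N m c → LightRestriction N (suc m) c
    light-suc (w , w≤m , p) = w , m≤n⇒m≤1+n w≤m , p

  restrict-weightVectors : ∀ {n} (N : Subset n) m → All (LightRestriction N m) (weightVectors n m)
  restrict-weightVectors []          zero    = (0 , z≤n , []) ∷ []
  restrict-weightVectors []          (suc m) = []
  restrict-weightVectors (true ∷ N)  zero    = All.map⁺ (All.map (light-z∷ N) (restrict-weightVectors N zero))
  restrict-weightVectors (true ∷ N)  (suc m) =
    All.++⁺ (All.map⁺ (All.map (light-z∷ N) (restrict-weightVectors N (suc m))))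
            (All.map⁺ (All.map (light-t∷ N) (restrict-weightVectors N m)))
  restrict-weightVectors (false ∷ N) zero    = All.map⁺ (restrict-weightVectors N zero)
  restrict-weightVectors (false ∷ N) (suc m) =
    All.++⁺ (All.map⁺ (restrict-weightVectors N (suc m)))
            (All.map⁺ (All.map (light-suc N) (restrict-weightVectors N m)))

  matchParity-weightVectors-heavy : ∀ {n} (N : Subset n) {b} m → (∀ {w} → Pattern b w → m < w) →
                                    matchParity N b (weightVectors n m) ≡ 0ℙ
  matchParity-weightVectors-heavy N m heavy =
    matchParity-none {N = N}
      (All.map (λ { (w , w≤m , p) refl → <⇒≱ (heavy p) w≤m }) (restrict-weightVectors N m))

  matchParity-weightVectors-false∷ : ∀ {n} (N : Subset n) b m →
    matchParity (false ∷ N) b (weightVectors (suc n) (suc m))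
      ≡ matchParity N b (weightVectors n (suc m)) ℙ.+ matchParity N b (weightVectors n m)
  matchParity-weightVectors-false∷ {n} N b m =
    trans (matchParity-++ (false ∷ N) b (map (z ∷_) W₁) (map (t ∷_) W₀))
          (cong₂ ℙ._+_ (matchParity-skip N b W₁) (matchParity-skip N b W₀))
    where
    W₁ W₀ : List (Vec (Fin M) n)
    W₁ = weightVectors n (suc m)
    W₀ = weightVectors n m

  matchParity-weightVectors-0∷ : ∀ {n} (N : Subset n) {x} b m → x ≡ 0 →
    matchParity (true ∷ N) (x ∷ b) (weightVectors (suc n) m) ≡ matchParity N b (weightVectors n m)
  matchParity-weightVectors-0∷ {n} N b zero    x≡0 =
    matchParity-keep N b (weightVectors n zero) (trans z≡0 (sym x≡0))
  matchParity-weightVectors-0∷ {n} N {x} b (suc m) x≡0 = begin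
    matchParity (true ∷ N) (x ∷ b) (map (z ∷_) W₁ ++ map (t ∷_) W₀)
      ≡⟨ matchParity-++ (true ∷ N) (x ∷ b) (map (z ∷_) W₁) (map (t ∷_) W₀) ⟩
    matchParity (true ∷ N) (x ∷ b) (map (z ∷_) W₁)
      ℙ.+ matchParity (true ∷ N) (x ∷ b) (map (t ∷_) W₀)
      ≡⟨ cong₂ ℙ._+_ (matchParity-keep N b W₁ (trans z≡0 (sym x≡0)))
                     (matchParity-drop N b W₀ λ t≡x → t≢0 (trans t≡x x≡0)) ⟩
    matchParity N b W₁ ℙ.+ 0ℙ
      ≡⟨ ℙ.+-identityʳ (matchParity N b W₁) ⟩
    matchParity N b W₁ ∎
    where
    open ≡-Reasoning
    W₁ W₀ : List (Vec (Fin M) n)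
    W₁ = weightVectors n (suc m)
    W₀ = weightVectors n m

  matchParity-weightVectors-t∷ : ∀ {n} (N : Subset n) {x} b m → x ≡ toℕ t →
    matchParity (true ∷ N) (x ∷ b) (weightVectors (suc n) (suc m)) ≡ matchParity N b (weightVectors n m)
  matchParity-weightVectors-t∷ {n} N {x} b m x≡t =
    trans (matchParity-++ (true ∷ N) (x ∷ b) (map (z ∷_) W₁) (map (t ∷_) W₀))
          (cong₂ ℙ._+_ (matchParity-drop N b W₁ λ z≡x → t≢0 (trans (sym x≡t) (trans (sym z≡x) z≡0)))
                       (matchParity-keep N b W₀ (sym x≡t)))
    where
    W₁ W₀ : List (Vec (Fin M) n)
    W₁ = weightVectors n (suc m)
    W₀ = weightVectors n m

  matchParity-weightVectors : ∀ {n} (N : Subset n) {b w} → Pattern b w → length b ≡ ∣ N ∣ → ∀ s →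
                              matchParity N b (weightVectors n (w + s)) ≡ parity (∣ ∁ N ∣ C s)
  matchParity-weightVectors []          []         _   zero    = refl
  matchParity-weightVectors []          []         _   (suc s) = refl
  matchParity-weightVectors (true ∷ N)  {w = w} (0∷ x≡0 p) len s =
    trans (matchParity-weightVectors-0∷ N _ (w + s) x≡0) (matchParity-weightVectors N p (suc-injective len) s)
  matchParity-weightVectors (true ∷ N)  {w = suc w} (t∷ x≡t p) len s =
    trans (matchParity-weightVectors-t∷ N _ (w + s) x≡t) (matchParity-weightVectors N p (suc-injective len) s)
  matchParity-weightVectors {suc n} (false ∷ N) {b} {zero} p len zero =
    trans (matchParity-skip N b (weightVectors n zero)) (matchParity-weightVectors N p len zero)
  matchParity-weightVectors (false ∷ N) {b} {suc w} p len zero =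
    trans (matchParity-weightVectors-false∷ N b (w + 0))
      (cong₂ ℙ._+_ (matchParity-weightVectors N p len zero)
                   (matchParity-weightVectors-heavy N (w + 0) λ q →
                      subst (w + 0 <_) (pattern-weight-unique p q) (s≤s (≤-reflexive (+-identityʳ w)))))
  matchParity-weightVectors {suc n} (false ∷ N) {b} {w} p len (suc s) = begin
    matchParity (false ∷ N) b (weightVectors (suc n) (w + suc s))
      ≡⟨ cong (matchParity (false ∷ N) b ∘ weightVectors (suc n)) (+-suc w s) ⟩
    matchParity (false ∷ N) b (weightVectors (suc n) (suc (w + s)))
      ≡⟨ matchParity-weightVectors-false∷ N b (w + s) ⟩
    matchParity N b (weightVectors n (suc (w + s))) ℙ.+ matchParity N b (weightVectors n (w + s))
      ≡⟨ cong₂ ℙ._+_ (trans (cong (matchParity N b ∘ weightVectors n) (sym (+-suc w s)))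
                            (matchParity-weightVectors N p len (suc s)))
                     (matchParity-weightVectors N p len s) ⟩
    parity (∣ ∁ N ∣ C suc s) ℙ.+ parity (∣ ∁ N ∣ C s)
      ≡⟨ ℙ.+-comm (parity (∣ ∁ N ∣ C suc s)) (parity (∣ ∁ N ∣ C s)) ⟩
    parity (∣ ∁ N ∣ C s) ℙ.+ parity (∣ ∁ N ∣ C suc s)
      ≡⟨ parity-pascal ∣ ∁ N ∣ s ⟨
    parity (suc ∣ ∁ N ∣ C suc s) ∎
    where open ≡-Reasoning

  matchParity-weightVectors-≤ : ∀ {n} (N : Subset n) {b w m} → Pattern b w → length b ≡ ∣ N ∣ →
                                w ≤ m → matchParity N b (weightVectors n m) ≡ parity (∣ ∁ N ∣ C (m ∸ w))
  matchParity-weightVectors-≤ {n} N {b} {w} {m} p len w≤m =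
    subst (λ m′ → matchParity N b (weightVectors n m′) ≡ parity (∣ ∁ N ∣ C (m ∸ w)))
          (m+[n∸m]≡n w≤m) (matchParity-weightVectors N p len (m ∸ w))

  matchParity-weightVectors-even : ∀ {n} (N : Subset n) {b} m → length b ≡ ∣ N ∣ →
    (∀ {w} → Pattern b w → w ≤ m → parity (∣ ∁ N ∣ C (m ∸ w)) ≡ 0ℙ) →
    matchParity N b (weightVectors n m) ≡ 0ℙ
  matchParity-weightVectors-even N {b} m len even with pattern? b
  ... | inj₂ ¬p      = matchParity-weightVectors-heavy N m λ p → contradiction p ¬p
  ... | inj₁ (w , p) with w ≤? m
  ...   | yes w≤m = trans (matchParity-weightVectors-≤ N p len w≤m) (even p w≤m)
  ...   | no  w≰m = matchParity-weightVectors-heavy N m λ q →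
                      subst (m <_) (pattern-weight-unique p q) (≰⇒> w≰m)

  weightVectors-unique : ∀ n m → Unique (weightVectors n m)
  weightVectors-unique zero    zero    = [] ∷ []
  weightVectors-unique zero    (suc m) = []
  weightVectors-unique (suc n) zero    = Unique.map⁺ ∷-injectiveʳ (weightVectors-unique n zero)
  weightVectors-unique (suc n) (suc m) =
    Unique-map-∷-++ (λ z≡t → t≢0 (trans (cong toℕ (sym z≡t)) z≡0))
                    (weightVectors-unique n (suc m)) (weightVectors-unique n m)

  vsum-weightVectors : ∀ n m → All (λ v → vsum v ≡ m * toℕ t) (weightVectors n m)
  vsum-weightVectors zero    zero    = refl ∷ []
  vsum-weightVectors zero    (suc m) = []
  vsum-weightVectors (suc n) zero    = All.map⁺ (All.map (cong₂ _+_ z≡0) (vsum-weightVectors n zero))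
  vsum-weightVectors (suc n) (suc m) =
    All.++⁺ (All.map⁺ (All.map (cong₂ _+_ z≡0) (vsum-weightVectors n (suc m))))
            (All.map⁺ (All.map (cong (toℕ t +_)) (vsum-weightVectors n m)))

module Construction (j q : ℕ) (j<q : j < q) where

  k : ℕ
  k = 2 ^ j ∸ 1

  T : ℕ
  T = 2 ^ q ∸ 1

  1+k≡2^j : suc k ≡ 2 ^ j
  1+k≡2^j = suc[2^n∸1]≡2^n j

  2^q≡1+T : 2 ^ q ≡ suc T
  2^q≡1+T = sym (suc[2^n∸1]≡2^n q)

  1+k<2^q : suc k < 2 ^ q
  1+k<2^q = subst (_< 2 ^ q) (sym 1+k≡2^j) (^-monoʳ-< 2 (s≤s (s≤s z≤n)) j<q)

  T≢0 : T ≢ 0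
  T≢0 T≡0 with subst (suc k <_) (trans 2^q≡1+T (cong suc T≡0)) 1+k<2^q
  ... | s≤s ()

  zeroᶠ minusOne first a : Fin (2 ^ q)
  zeroᶠ    = fromℕ< (m^n>0 2 q)
  minusOne = fromℕ< (subst (T <_) (sym 2^q≡1+T) (n<1+n T))
  first    = fromℕ< (<-trans (n<1+n k) 1+k<2^q)
  a        = fromℕ< 1+k<2^q

  open WeightVectors zeroᶠ minusOne (toℕ-fromℕ< _) (T≢0 ∘ trans (sym (toℕ-fromℕ< _)))

  n : ℕ
  n = k + k

  Wₖ Wₖ₊₁ : List (Vec (Fin (2 ^ q)) n)
  Wₖ   = weightVectors n k
  Wₖ₊₁ = weightVectors n (suc k)

  Ξ : List (Vec (Fin (2 ^ q)) (suc n))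
  Ξ = map (first ∷_) Wₖ ++ map (a ∷_) Wₖ₊₁

  1+2k≡2^[1+j]∸1 : suc (k + k) ≡ 2 ^ suc j ∸ 1
  1+2k≡2^[1+j]∸1 = begin
    suc (k + k)              ≡⟨ +-suc k k ⟨
    suc k + suc k ∸ 1        ≡⟨ cong (λ K → K + K ∸ 1) 1+k≡2^j ⟩
    2 ^ j + 2 ^ j ∸ 1        ≡⟨ cong (λ x → 2 ^ j + x ∸ 1) (+-identityʳ (2 ^ j)) ⟨
    2 ^ suc j ∸ 1            ∎
    where open ≡-Reasoning

  parity-[1+k]Cs≡0ℙ : ∀ {s} → 0 < s → s ≤ k → parity (suc k C s) ≡ 0ℙ
  parity-[1+k]Cs≡0ℙ {s} 0<s s≤k = subst (λ K → parity (K C s) ≡ 0ℙ) (sym 1+k≡2^j)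
    (parity-[2^j]Cs≡0ℙ j 0<s (subst (s <_) 1+k≡2^j (s≤s s≤k)))

  parity-kCs≡1ℙ : ∀ {s} → s ≤ k → parity (k C s) ≡ 1ℙ
  parity-kCs≡1ℙ = parity-nCs≡1ℙ parity-[1+k]Cs≡0ℙ

  ∣∁N∣≡k : (N : Subset n) → ∣ N ∣ ≡ k → ∣ ∁ N ∣ ≡ k
  ∣∁N∣≡k N |N|≡k = trans (∣∁p∣≡n∸∣p∣ N) (trans (cong (n ∸_) |N|≡k) (m+n∸n≡m k k))

  ∣∁N∣≡1+k : (N : Subset n) → suc ∣ N ∣ ≡ k → ∣ ∁ N ∣ ≡ suc k
  ∣∁N∣≡1+k N 1+|N|≡k = begin
    ∣ ∁ N ∣                    ≡⟨ ∣∁p∣≡n∸∣p∣ N ⟩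
    k + k ∸ ∣ N ∣              ≡⟨ cong (λ x → x + k ∸ ∣ N ∣) 1+|N|≡k ⟨
    suc ∣ N ∣ + k ∸ ∣ N ∣      ≡⟨ cong (_∸ ∣ N ∣) (+-suc ∣ N ∣ k) ⟨
    ∣ N ∣ + suc k ∸ ∣ N ∣      ≡⟨ m+n∸m≡n ∣ N ∣ (suc k) ⟩
    suc k                      ∎
    where open ≡-Reasoning

  matchParity-Ξ-false∷ : ∀ (N : Subset n) b →
                         matchParity (false ∷ N) b Ξ ≡ matchParity N b Wₖ ℙ.+ matchParity N b Wₖ₊₁
  matchParity-Ξ-false∷ N b =
    trans (matchParity-++ (false ∷ N) b (map (first ∷_) Wₖ) (map (a ∷_) Wₖ₊₁))
          (cong₂ ℙ._+_ (matchParity-skip N b Wₖ) (matchParity-skip N b Wₖ₊₁))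

  matchParity-Ξ-outside-special : ∀ (N : Subset n) → ∣ N ∣ ≡ k →
                                  matchParity (false ∷ N) (replicate ∣ N ∣ 0) Ξ ≡ 1ℙ
  matchParity-Ξ-outside-special N |N|≡k = begin
    matchParity (false ∷ N) zeros Ξ
      ≡⟨ matchParity-Ξ-false∷ N zeros ⟩
    matchParity N zeros Wₖ ℙ.+ matchParity N zeros Wₖ₊₁
      ≡⟨ cong₂ ℙ._+_ (matchParity-weightVectors-≤ N (replicate-pattern ∣ N ∣) len z≤n)
                     (matchParity-weightVectors-≤ N (replicate-pattern ∣ N ∣) len z≤n) ⟩
    parity (∣ ∁ N ∣ C k) ℙ.+ parity (∣ ∁ N ∣ C suc k)
      ≡⟨ cong (λ f → parity (f C k) ℙ.+ parity (f C suc k)) (∣∁N∣≡k N |N|≡k) ⟩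
    parity (k C k) ℙ.+ parity (k C suc k)
      ≡⟨ cong₂ (λ x y → parity x ℙ.+ parity y) (nCn≡1 k) (k>n⇒nCk≡0 (n<1+n k)) ⟩
    1ℙ ∎
    where
    open ≡-Reasoning
    zeros : List ℕ
    zeros = replicate ∣ N ∣ 0
    len : length zeros ≡ ∣ N ∣
    len = length-replicate ∣ N ∣

  matchParity-Ξ-outside-other : ∀ (N : Subset n) b → ∣ N ∣ ≡ k → length b ≡ ∣ N ∣ →
                                b ≢ replicate ∣ N ∣ 0 → matchParity (false ∷ N) b Ξ ≡ 0ℙ
  matchParity-Ξ-outside-other N b |N|≡k len b≢0 with pattern? b
  ... | inj₂ ¬p = trans (matchParity-Ξ-false∷ N b)
    (cong₂ ℙ._+_ (matchParity-weightVectors-heavy N k λ p → contradiction p ¬p)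
                 (matchParity-weightVectors-heavy N (suc k) λ p → contradiction p ¬p))
  ... | inj₁ (zero , p) = contradiction (pattern-weight-0 len p) b≢0
  -- For a pattern of weight w ≥ 1 both halves are odd, k C (k - w) and k C (k + 1 - w), and cancel.
  ... | inj₁ (suc w , p) = trans (matchParity-Ξ-false∷ N b)
    (cong₂ ℙ._+_ (odd (k ∸ suc w) (matchParity-weightVectors-≤ N p len w<k) (m∸n≤m k (suc w)))
                 (odd (k ∸ w) (matchParity-weightVectors-≤ N p len (m≤n⇒m≤1+n w<k)) (m∸n≤m k w)))
    where
    w<k : suc w ≤ k
    w<k = subst (suc w ≤_) (trans len |N|≡k) (pattern-weight≤length p)
    odd : ∀ {W} s → W ≡ parity (∣ ∁ N ∣ C s) → s ≤ k → W ≡ 1ℙ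
    odd s W≡ s≤k =
      trans W≡ (trans (cong (λ f → parity (f C s)) (∣∁N∣≡k N |N|≡k)) (parity-kCs≡1ℙ s≤k))

  toℕ-first≢toℕ-a : toℕ first ≢ toℕ a
  toℕ-first≢toℕ-a eq = 1+n≢n (sym (trans (sym (toℕ-fromℕ< _)) (trans eq (toℕ-fromℕ< _))))

  matchParity-Ξ-inside-special : ∀ (N : Subset n) → suc ∣ N ∣ ≡ k →
                                 matchParity (true ∷ N) (toℕ a ∷ replicate ∣ N ∣ 0) Ξ ≡ 1ℙ
  matchParity-Ξ-inside-special N 1+|N|≡k = begin
    matchParity (true ∷ N) (toℕ a ∷ zeros) Ξ
      ≡⟨ matchParity-++ (true ∷ N) (toℕ a ∷ zeros) (map (first ∷_) Wₖ) (map (a ∷_) Wₖ₊₁) ⟩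
    matchParity (true ∷ N) (toℕ a ∷ zeros) (map (first ∷_) Wₖ)
      ℙ.+ matchParity (true ∷ N) (toℕ a ∷ zeros) (map (a ∷_) Wₖ₊₁)
      ≡⟨ cong₂ ℙ._+_ (matchParity-drop N zeros Wₖ toℕ-first≢toℕ-a)
                     (matchParity-keep N zeros Wₖ₊₁ refl) ⟩
    matchParity N zeros Wₖ₊₁
      ≡⟨ matchParity-weightVectors-≤ N (replicate-pattern ∣ N ∣) (length-replicate ∣ N ∣) z≤n ⟩
    parity (∣ ∁ N ∣ C suc k)
      ≡⟨ cong (λ f → parity (f C suc k)) (∣∁N∣≡1+k N 1+|N|≡k) ⟩
    parity (suc k C suc k)
      ≡⟨ cong parity (nCn≡1 (suc k)) ⟩
    1ℙ ∎
    where
    open ≡-Reasoning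
    zeros : List ℕ
    zeros = replicate ∣ N ∣ 0

  matchParity-Ξ-inside-other : ∀ (N : Subset n) x b → suc ∣ N ∣ ≡ k → length b ≡ ∣ N ∣ →
                               x ∷ b ≢ toℕ a ∷ replicate ∣ N ∣ 0 →
                               matchParity (true ∷ N) (x ∷ b) Ξ ≡ 0ℙ
  matchParity-Ξ-inside-other N x b 1+|N|≡k len x∷b≢special =
    trans (matchParity-++ (true ∷ N) (x ∷ b) (map (first ∷_) Wₖ) (map (a ∷_) Wₖ₊₁))
          (cong₂ ℙ._+_ first-half second-half)
    where
    even : ∀ {s} → 0 < s → s ≤ k → parity (∣ ∁ N ∣ C s) ≡ 0ℙ
    even {s} 0<s s≤k =
      trans (cong (λ f → parity (f C s)) (∣∁N∣≡1+k N 1+|N|≡k)) (parity-[1+k]Cs≡0ℙ 0<s s≤k)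

    w<k : ∀ {w} → Pattern b w → w < k
    w<k {w} p = subst (w <_) 1+|N|≡k (s≤s (subst (w ≤_) len (pattern-weight≤length p)))

    first-half : matchParity (true ∷ N) (x ∷ b) (map (first ∷_) Wₖ) ≡ 0ℙ
    first-half with toℕ first ≟ x
    ... | no  first≢x = matchParity-drop N b Wₖ first≢x
    ... | yes first≡x = trans (matchParity-keep N b Wₖ first≡x)
      (matchParity-weightVectors-even N k len λ {w} p _ → even (m<n⇒0<n∸m (w<k p)) (m∸n≤m k w))

    nonzero-even : toℕ a ≡ x → ∀ {w} → Pattern b w → w ≤ suc k →
                   parity (∣ ∁ N ∣ C (suc k ∸ w)) ≡ 0ℙ
    nonzero-even a≡x {zero}  p _ =
      contradiction (cong₂ _∷_ (sym a≡x) (pattern-weight-0 len p)) x∷b≢special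
    nonzero-even _   {suc w} p _ = even (m<n⇒0<n∸m (<-trans (n<1+n w) (w<k p))) (m∸n≤m k w)

    second-half : matchParity (true ∷ N) (x ∷ b) (map (a ∷_) Wₖ₊₁) ≡ 0ℙ
    second-half with toℕ a ≟ x
    ... | no  a≢x = matchParity-drop N b Wₖ₊₁ a≢x
    ... | yes a≡x = trans (matchParity-keep N b Wₖ₊₁ a≡x)
      (matchParity-weightVectors-even N (suc k) len (nonzero-even a≡x))

  divisible : ∀ (x : Fin (2 ^ q)) c {v : Vec (Fin (2 ^ q)) n} →
              toℕ x ≡ c → vsum v ≡ c * toℕ minusOne → 2 ^ q ∣ vsum (x ∷ v)
  divisible x c {v} x≡c v≡cT = divides c (begin
    toℕ x + vsum v           ≡⟨ cong₂ _+_ x≡c (trans v≡cT (cong (c *_) (toℕ-fromℕ< _))) ⟩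
    c + c * T                ≡⟨ *-suc c T ⟨
    c * suc T                ≡⟨ cong (c *_) 2^q≡1+T ⟨
    c * 2 ^ q                ∎)
    where open ≡-Reasoning

  Ξ-blurer : Blurer k q a (suc n) Ξ
  Ξ-blurer = record
    { d≥k      = m≤n⇒m≤1+n (m≤m+n k k)
    ; isSet    = Unique-map-∷-++ (toℕ-first≢toℕ-a ∘ cong toℕ)
                   (weightVectors-unique n k) (weightVectors-unique n (suc k))
    ; sumZero  = All.++⁺
                   (All.map⁺ (All.map (λ {v} → divisible first k {v} (toℕ-fromℕ< _)) (vsum-weightVectors n k)))
                   (All.map⁺ (All.map (λ {v} → divisible a (suc k) {v} (toℕ-fromℕ< _))
                                      (vsum-weightVectors n (suc k))))
    ; special1 = special1
    ; others0  = others0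
    }
    where
    special1 : ∀ N → ∣ N ∣ ≡ k → count# N (special a N) Ξ ≡ 1
    special1 (true ∷ N)  |N|≡k = count#≡1 (true ∷ N) _ Ξ (matchParity-Ξ-inside-special N |N|≡k)
    special1 (false ∷ N) |N|≡k = count#≡1 (false ∷ N) _ Ξ (matchParity-Ξ-outside-special N |N|≡k)

    others0 : ∀ N → ∣ N ∣ ≡ k → (b : List (Fin (2 ^ q))) → length b ≡ ∣ N ∣ →
              map toℕ b ≢ special a N → count# N (map toℕ b) Ξ ≡ 0
    others0 (true ∷ N)  |N|≡k (x ∷ b) len ≢special = count#≡0 (true ∷ N) _ Ξ
      (matchParity-Ξ-inside-other N (toℕ x) (map toℕ b) |N|≡k
                                  (trans (length-map toℕ b) (suc-injective len)) ≢special)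
    others0 (false ∷ N) |N|≡k b       len ≢special = count#≡0 (false ∷ N) _ Ξ
      (matchParity-Ξ-outside-other N (map toℕ b) |N|≡k (trans (length-map toℕ b) len) ≢special)

mainTheorem11 : (i ℓ : ℕ) → i ≥ 1 →
    Σ (Fin (2 ^ (i + ℓ))) λ a → toℕ a ≡ 2 ^ (i ∸ 1) ×
      Σ (List (Vec (Fin (2 ^ (i + ℓ))) (2 ^ i ∸ 1))) λ Ξ →
        Blurer (2 ^ (i ∸ 1) ∸ 1) (i + ℓ) a (2 ^ i ∸ 1) Ξ
mainTheorem11 (suc j) ℓ _ =
  a , trans (toℕ-fromℕ< _) 1+k≡2^j ,
  subst (λ d → Σ (List (Vec (Fin (2 ^ (suc j + ℓ))) d)) (Blurer k (suc j + ℓ) a d))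
        1+2k≡2^[1+j]∸1 (Ξ , Ξ-blurer)
  where open Construction j (suc j + ℓ) (s≤s (m≤m+n j ℓ))
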